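{- Let $G$ be a connected graph. Then $G_{SR}=G^c$ (that is, the strong resolving graph of $G$ has exactly the edge set of the complement of $G$) if and only if $D(G)=2$ and $G$ has no pair of distinct true twins.
   Context: All graphs are finite, simple and undirected; $G^c$ denotes the complement of $G$ on the same vertex set and $D(G)$ the diameter of $G$. For a connected graph $G$, $d_G(x,y)$ is the length of a shortest $x$–$y$ path, $N_G(x)$ the open and $N_G[x]=N_G(x)\cup\{x\}$ the closed neighbourhood. A vertex $u$ is maximally distant from $v$ if $d_G(v,w)\le d_G(u,v)$ for every $w\in N_G(u)$; $u,v$ are mutually maximally distant if each is maximally distant from the other. The strong resolving graph $G_{SR}$ of $G$ has vertex set $V(G)$, two vertices being adjacent in $G_{SR}$ iff they are mutually maximally distant in $G$. Two distinct vertices $x,y$ are true twins if $N_G[x]=N_G[y]$; $G$ is true twin-free if it has no pair of true twins. -}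

module Defs where

open import Data.Nat using (ℕ; zero; suc; _≤_; _<_)
open import Data.Fin using (Fin)
open import Data.Bool using (Bool; true; false)
open import Data.Product using (_×_; ∃-syntax)
open import Data.Sum using (_⊎_)
open import Relation.Nullary using (¬_)
open import Relation.Binary.PropositionalEquality using (_≡_)
open import Function.Bundles using (_⇔_)

record Graph (n : ℕ) : Set where
  field
    E      : Fin n → Fin n → Bool
    sym    : ∀ x y → E x y ≡ E y x
    irrefl : ∀ x → E x x ≡ false

module _ {n : ℕ} (G : Graph n) where
  open Graph G

  Adj : Fin n → Fin n → Set
  Adj x y = E x y ≡ true

  AdjC : Fin n → Fin n → Set
  AdjC x y = ¬ (x ≡ y) × ¬ Adj x y

  data Walk : Fin n → Fin n → ℕ → Set where
    here : ∀ {x} → Walk x x zero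
    step : ∀ {x y z k} → Adj x y → Walk y z k → Walk x z (suc k)

  Dist : Fin n → Fin n → ℕ → Set
  Dist x y k = Walk x y k × (∀ m → m < k → ¬ Walk x y m)

  Connected : Set
  Connected = ∀ x y → ∃[ k ] Walk x y k

  Diameter : ℕ → Set
  Diameter d = (∀ x y k → Dist x y k → k ≤ d) × ∃[ x ] ∃[ y ] Dist x y d

  MaxDist : Fin n → Fin n → Set
  MaxDist u v = ∀ w k l → Adj u w → Dist v w k → Dist u v l → k ≤ l

  MutMaxDist : Fin n → Fin n → Set
  MutMaxDist u v = MaxDist u v × MaxDist v u

  AdjSR : Fin n → Fin n → Set
  AdjSR u v = ¬ (u ≡ v) × MutMaxDist u v

  InClosedNbhd : Fin n → Fin n → Set
  InClosedNbhd x z = z ≡ x ⊎ Adj x z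

  TrueTwins : Fin n → Fin n → Set
  TrueTwins x y = ¬ (x ≡ y) × (∀ z → InClosedNbhd x z ⇔ InClosedNbhd y z)

  TrueTwinFree : Set
  TrueTwinFree = ∀ x y → ¬ TrueTwins x y

  SRisComplement : Set
  SRisComplement = ∀ u v → AdjSR u v ⇔ AdjC u v

module Submission where

-- For adjacent x, y, being mutually maximally distant amounts to N[x] = N[y],
-- i.e. to being true twins; for non-adjacent x, y in a graph of diameter 2 it
-- holds trivially, as d(x, y) = 2 is as large as any distance.  Conversely, if
-- G_SR = G^c then on a geodesic x u₁ u₂ u₃ … the vertex u₂ would be a
-- non-neighbour of x that is not maximally distant from it, so distances are at
-- most 2; and as a complete graph on at least two vertices has true twins, some
-- distance equals 2.

open import Defs
open import Data.Nat using (ℕ; zero; suc; _+_; _≤_; _<_; z≤n; s≤s)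
open import Data.Nat.Properties using (≮⇒≥; ≤-trans; ≤-antisym; +-monoˡ-<; anyUpTo?)
open import Data.Nat.Induction using (<-rec)
open import Data.Fin using (Fin; _≟_) renaming (zero to 0F; suc to sucF)
open import Data.Fin.Properties using (any?)
open import Data.Bool using (true)
import Data.Bool.Properties as Bool
open import Data.Product using (_×_; _,_; proj₁; proj₂; ∃-syntax)
open import Data.Sum using (inj₁; inj₂)
open import Data.Empty using (⊥-elim)
open import Function.Bundles using (_⇔_; mk⇔; Equivalence)
open import Relation.Nullary using (¬_; Dec; yes; no; contradiction)
open import Relation.Nullary.Decidable using (_×-dec_; ¬?; decidable-stable)
open import Relation.Binary.PropositionalEquality using (_≡_; _≢_; refl; sym; trans; subst)

module GraphProperties {n : ℕ} (G : Graph n) where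
  open Graph G using (E; irrefl)

  private
    variable
      x y z : Fin n
      a b k l m d : ℕ

  Adj-sym : Adj G x y → Adj G y x
  Adj-sym {x} {y} = trans (Graph.sym G y x)

  Adj⇒≢ : Adj G x y → x ≢ y
  Adj⇒≢ {x} xy refl with trans (sym xy) (irrefl x)
  ... | ()

  adj? : ∀ x y → Dec (Adj G x y)
  adj? x y = E x y Bool.≟ true

  AdjC-sym : AdjC G x y → AdjC G y x
  AdjC-sym (x≢y , ¬xy) = (λ y≡x → x≢y (sym y≡x)) , (λ yx → ¬xy (Adj-sym yx))

  ClosedNbhd⊆ : Fin n → Fin n → Set
  ClosedNbhd⊆ x y = ∀ z → InClosedNbhd G x z → InClosedNbhd G y z

  DistancesAtMost : ℕ → Set
  DistancesAtMost d = ∀ x y k → Dist G x y k → k ≤ d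

  Walk₀⇒≡ : Walk G x y 0 → x ≡ y
  Walk₀⇒≡ here = refl

  Walk₁⇒Adj : Walk G x y 1 → Adj G x y
  Walk₁⇒Adj (step xy here) = xy

  _++_ : Walk G x y a → Walk G y z b → Walk G x z (a + b)
  here       ++ q = q
  step xy p ++ q = step xy (p ++ q)

  _∷ʳ_ : Walk G x y k → Adj G y z → Walk G x z (suc k)
  here      ∷ʳ yz = step yz here
  step xy p ∷ʳ yz = step xy (p ∷ʳ yz)

  reverse : Walk G x y k → Walk G y x k
  reverse here        = here
  reverse (step xy p) = reverse p ∷ʳ Adj-sym xy

  walk? : ∀ k x y → Dec (Walk G x y k)
  walk? zero x y with x ≟ y
  ... | yes refl = yes here
  ... | no x≢y   = no λ p → x≢y (Walk₀⇒≡ p)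
  walk? (suc k) x y with any? (λ z → adj? x z ×-dec walk? k z y)
  ... | yes (z , xz , p) = yes (step xz p)
  ... | no none          = no λ { (step xz p) → none (_ , xz , p) }

  Dist-sym : Dist G x y k → Dist G y x k
  Dist-sym (p , minimal) = reverse p , λ m m<k q → minimal m m<k (reverse q)

  Dist⇒≤length : Dist G x y l → Walk G x y m → l ≤ m
  Dist⇒≤length (_ , minimal) p = ≮⇒≥ (λ m<l → minimal _ m<l p)

  Walk⇒Dist : Walk G x y k → ∃[ m ] Dist G x y m
  Walk⇒Dist {x} {y} {k} = <-rec (λ k → Walk G x y k → ∃[ m ] Dist G x y m) shorten k
    where
    shorten : ∀ k → (∀ {m} → m < k → Walk G x y m → ∃[ l ] Dist G x y l) →
              Walk G x y k → ∃[ l ] Dist G x y l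
    shorten k rec p with anyUpTo? (λ m → walk? m x y) k
    ... | yes (m , m<k , q) = rec m<k q
    ... | no none           = k , p , λ m m<k q → none (m , m<k , q)

  Adj⇒Dist₁ : Adj G x y → Dist G x y 1
  Adj⇒Dist₁ xy = step xy here , λ { zero _ p → Adj⇒≢ xy (Walk₀⇒≡ p) ; (suc _) (s≤s ()) _ }

  Dist-prefix : (p : Walk G x y a) → Walk G y z b → Dist G x z (a + b) → Dist G x y a
  Dist-prefix p q (_ , minimal) =
    p , λ m m<a p′ → minimal (m + _) (+-monoˡ-< _ m<a) (p′ ++ q)

  ≢⇒Dist≥1 : x ≢ y → Dist G x y l → 1 ≤ l
  ≢⇒Dist≥1 {l = zero}  x≢y (p , _) = contradiction (Walk₀⇒≡ p) x≢y
  ≢⇒Dist≥1 {l = suc l} _   _       = s≤s z≤n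

  AdjC⇒Dist≥2 : AdjC G x y → Dist G x y l → 2 ≤ l
  AdjC⇒Dist≥2 {l = zero}        (x≢y , _) (p , _) = contradiction (Walk₀⇒≡ p) x≢y
  AdjC⇒Dist≥2 {l = suc zero}    (_ , ¬xy) (p , _) = contradiction (Walk₁⇒Adj p) ¬xy
  AdjC⇒Dist≥2 {l = suc (suc l)} _         _       = s≤s (s≤s z≤n)

  InClosedNbhd⇒Dist≤1 : InClosedNbhd G x y → Dist G x y k → k ≤ 1
  InClosedNbhd⇒Dist≤1 (inj₁ refl) dist = ≤-trans (Dist⇒≤length dist here) z≤n
  InClosedNbhd⇒Dist≤1 (inj₂ xy)   dist = Dist⇒≤length dist (step xy here)

  Dist≤1⇒InClosedNbhd : Dist G x y k → k ≤ 1 → InClosedNbhd G x y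
  Dist≤1⇒InClosedNbhd {k = zero}        (p , _) _ = inj₁ (sym (Walk₀⇒≡ p))
  Dist≤1⇒InClosedNbhd {k = suc zero}    (p , _) _ = inj₂ (Walk₁⇒Adj p)
  Dist≤1⇒InClosedNbhd {k = suc (suc k)} _ (s≤s ())

  ClosedNbhd⊆⇒MaxDist : x ≢ y → ClosedNbhd⊆ x y → MaxDist G x y
  ClosedNbhd⊆⇒MaxDist x≢y N[x]⊆N[y] w k l xw dist-yw dist-xy =
    ≤-trans (InClosedNbhd⇒Dist≤1 (N[x]⊆N[y] w (inj₂ xw)) dist-yw) (≢⇒Dist≥1 x≢y dist-xy)

  MaxDist⇒ClosedNbhd⊆ : Connected G → Adj G x y → MaxDist G x y → ClosedNbhd⊆ x y
  MaxDist⇒ClosedNbhd⊆ conn xy _  z (inj₁ refl) = inj₂ (Adj-sym xy)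
  MaxDist⇒ClosedNbhd⊆ conn xy md z (inj₂ xz) with Walk⇒Dist (proj₂ (conn _ z))
  ... | k , dist = Dist≤1⇒InClosedNbhd dist (md z k 1 xz dist (Adj⇒Dist₁ xy))

  eccentric⇒MaxDist : (∀ w k → Dist G y w k → k ≤ d) → (∀ l → Dist G x y l → d ≤ l) → MaxDist G x y
  eccentric⇒MaxDist ecc far w k l _ dist-yw dist-xy = ≤-trans (ecc w k dist-yw) (far l dist-xy)

  TrueTwins⇒Adj : TrueTwins G x y → Adj G x y
  TrueTwins⇒Adj (x≢y , twins) with Equivalence.from (twins _) (inj₁ refl)
  ... | inj₁ y≡x = contradiction (sym y≡x) x≢y
  ... | inj₂ xy  = xy

  TrueTwins⇒MutMaxDist : TrueTwins G x y → MutMaxDist G x y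
  TrueTwins⇒MutMaxDist (x≢y , twins) =
      ClosedNbhd⊆⇒MaxDist x≢y (λ z → Equivalence.to (twins z))
    , ClosedNbhd⊆⇒MaxDist (λ y≡x → x≢y (sym y≡x)) (λ z → Equivalence.from (twins z))

  Adj∧MutMaxDist⇒TrueTwins : Connected G → Adj G x y → MutMaxDist G x y → TrueTwins G x y
  Adj∧MutMaxDist⇒TrueTwins conn xy (md-xy , md-yx) =
    Adj⇒≢ xy , λ z → mk⇔ (MaxDist⇒ClosedNbhd⊆ conn xy md-xy z)
                         (MaxDist⇒ClosedNbhd⊆ conn (Adj-sym xy) md-yx z)

  complete⇒TrueTwins : (∀ u v → u ≢ v → Adj G u v) → x ≢ y → TrueTwins G x y
  complete⇒TrueTwins complete x≢y =
    x≢y , λ z → mk⇔ (λ _ → everywhere z) (λ _ → everywhere z)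
    where
    everywhere : ∀ {u} z → InClosedNbhd G u z
    everywhere {u} z with z ≟ u
    ... | yes z≡u = inj₁ z≡u
    ... | no  z≢u = inj₂ (complete u z (λ u≡z → z≢u (sym u≡z)))

  TrueTwinFree⇒nonadjacentPair : TrueTwinFree G → x ≢ y → ∃[ u ] ∃[ v ] AdjC G u v
  TrueTwinFree⇒nonadjacentPair {x} {y} twinFree x≢y
    with any? (λ u → any? (λ v → ¬? (u ≟ v) ×-dec ¬? (adj? u v)))
  ... | yes (u , v , uv) = u , v , uv
  ... | no none = contradiction (complete⇒TrueTwins complete x≢y) (twinFree x y)
    where
    complete : ∀ u v → u ≢ v → Adj G u v
    complete u v u≢v = decidable-stable (adj? u v) λ ¬uv → none (u , v , u≢v , ¬uv)

  Dist≥3⇒nonMaxDistant : Dist G x y (3 + k) → ∃[ u ] AdjC G x u × ¬ MaxDist G u x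
  Dist≥3⇒nonMaxDistant {x} dist@(step xu₁ (step {y = u₂} u₁u₂ (step {y = u₃} u₂u₃ rest)) , _) =
    u₂ , x≁u₂ , λ md → 3≰2 (md u₃ 3 2 u₂u₃ dist-xu₃ (Dist-sym dist-xu₂))
    where
    dist-xu₂ : Dist G x u₂ 2
    dist-xu₂ = Dist-prefix (step xu₁ (step u₁u₂ here)) (step u₂u₃ rest) dist
    dist-xu₃ : Dist G x u₃ 3
    dist-xu₃ = Dist-prefix (step xu₁ (step u₁u₂ (step u₂u₃ here))) rest dist
    x≁u₂ : AdjC G x u₂
    x≁u₂ = (λ { refl → proj₂ dist-xu₂ 0 (s≤s z≤n) here })
         , (λ xu₂ → proj₂ dist-xu₂ 1 (s≤s (s≤s z≤n)) (step xu₂ here))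
    3≰2 : ¬ 3 ≤ 2
    3≰2 (s≤s (s≤s ()))

  SRisComplement⇒TrueTwinFree : SRisComplement G → TrueTwinFree G
  SRisComplement⇒TrueTwinFree sr x y twins =
    proj₂ (Equivalence.to (sr x y) (proj₁ twins , TrueTwins⇒MutMaxDist twins)) (TrueTwins⇒Adj twins)

  SRisComplement⇒Dist≤2 : SRisComplement G → DistancesAtMost 2
  SRisComplement⇒Dist≤2 sr x y zero                _    = z≤n
  SRisComplement⇒Dist≤2 sr x y (suc zero)          _    = s≤s z≤n
  SRisComplement⇒Dist≤2 sr x y (suc (suc zero))    _    = s≤s (s≤s z≤n)
  SRisComplement⇒Dist≤2 sr x y (suc (suc (suc k))) dist with Dist≥3⇒nonMaxDistant dist
  ... | u , x≁u , ¬md = ⊥-elim (¬md (proj₁ (proj₂ (Equivalence.from (sr u x) (AdjC-sym x≁u)))))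

  Dist≤2∧AdjC⇒Diameter2 : Connected G → DistancesAtMost 2 → ∃[ x ] ∃[ y ] AdjC G x y → Diameter G 2
  Dist≤2∧AdjC⇒Diameter2 conn bounded (x , y , x≁y) with Walk⇒Dist (proj₂ (conn x y))
  ... | k , dist = bounded , x , y , subst (Dist G x y) k≡2 dist
    where
    k≡2 : k ≡ 2
    k≡2 = ≤-antisym (bounded x y k dist) (AdjC⇒Dist≥2 x≁y dist)

  Dist≤2∧AdjC⇒MaxDist : DistancesAtMost 2 → AdjC G x y → MaxDist G x y
  Dist≤2∧AdjC⇒MaxDist bounded x≁y = eccentric⇒MaxDist (bounded _) (λ _ → AdjC⇒Dist≥2 x≁y)

mainTheorem8 : ∀ (n : ℕ) → 2 ≤ n → (G : Graph n) → Connected G →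
    SRisComplement G ⇔ (Diameter G 2 × TrueTwinFree G)
mainTheorem8 (suc (suc n)) (s≤s (s≤s _)) G conn = mk⇔ necessary sufficient
  where
  open GraphProperties G

  necessary : SRisComplement G → Diameter G 2 × TrueTwinFree G
  necessary sr = Dist≤2∧AdjC⇒Diameter2 conn (SRisComplement⇒Dist≤2 sr)
                   (TrueTwinFree⇒nonadjacentPair twinFree 0≢1)
                 , twinFree
    where
    twinFree : TrueTwinFree G
    twinFree = SRisComplement⇒TrueTwinFree sr
    0≢1 : 0F ≢ sucF 0F
    0≢1 ()

  sufficient : Diameter G 2 × TrueTwinFree G → SRisComplement G
  sufficient ((bounded , _) , twinFree) u v = mk⇔ SR⇒C C⇒SR
    where
    SR⇒C : AdjSR G u v → AdjC G u v
    SR⇒C (u≢v , mmd) = u≢v , λ uv → twinFree u v (Adj∧MutMaxDist⇒TrueTwins conn uv mmd)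
    C⇒SR : AdjC G u v → AdjSR G u v
    C⇒SR u≁v = proj₁ u≁v
             , Dist≤2∧AdjC⇒MaxDist bounded u≁v , Dist≤2∧AdjC⇒MaxDist bounded (AdjC-sym u≁v)
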